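{- A graph $G$ is switching equivalent to a threshold graph if and only if $G$ has no induced subgraph which is switching equivalent to $3K_2$, to $C_5$, or to $C_4+2K_1$.
   Context: Graphs are finite and simple. A threshold graph is a graph in which every induced subgraph has an isolated vertex or a universal vertex. For $G=(V,E)$ and $S\subseteq V$, switching $G$ with respect to $S$ means: for every pair $\{u,v\}$ with $u\in S$, $v\notin S$, add the edge if absent and remove it if present; other pairs are unchanged. Two graphs on the same vertex set are switching equivalent if one is obtained from the other by switching with respect to some subset. $3K_2$ is three disjoint edges, $C_5$ is the 5-cycle, and $C_4+2K_1$ is a 4-cycle plus two isolated vertices. -}

module Defs where

open import Data.Nat using (ℕ)
open import Data.Fin using (Fin; zero; suc)
open import Data.Bool using (Bool; true; false; _xor_)
open import Data.Product using (Σ; ∃; _×_; _,_)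
open import Data.Sum using (_⊎_)
open import Relation.Nullary using (¬_)
open import Relation.Binary.PropositionalEquality using (_≡_; _≢_)
open import Function.Definitions using (Injective)

record Graph (n : ℕ) : Set where
  field
    adj    : Fin n → Fin n → Bool
    sym    : ∀ i j → adj i j ≡ adj j i
    irrefl : ∀ i → adj i i ≡ false
open Graph public

VSet : ℕ → Set
VSet n = Fin n → Bool

switchAdj : ∀ {n} → Graph n → VSet n → Fin n → Fin n → Bool
switchAdj G S i j = adj G i j xor (S i xor S j)

IsThresholdAdj : ∀ {n} → (Fin n → Fin n → Bool) → Set
IsThresholdAdj {n} a =
  (U : VSet n) → (∃ λ u → U u ≡ true) →
  ∃ λ v → U v ≡ true ×
    ((∀ w → U w ≡ true → w ≢ v → a v w ≡ false)
     ⊎ (∀ w → U w ≡ true → w ≢ v → a v w ≡ true))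

IsThreshold : ∀ {n} → Graph n → Set
IsThreshold G = IsThresholdAdj (adj G)

switch : ∀ {n} → Graph n → VSet n → Graph n
switch G S = record { adj = switchAdj G S ; sym = symP ; irrefl = irr }
  where
  open import Relation.Binary.PropositionalEquality using (refl; cong₂)
  open import Data.Bool.Properties using (xor-comm)
  symP : ∀ i j → switchAdj G S i j ≡ switchAdj G S j i
  symP i j = cong₂ _xor_ (Graph.sym G i j) (xor-comm (S i) (S j))
  irr : ∀ i → switchAdj G S i i ≡ false
  irr i with adj G i i | Graph.irrefl G i | S i
  ... | false | refl | true = refl
  ... | false | refl | false = refl

SwitchingThreshold : ∀ {n} → Graph n → Set
SwitchingThreshold G = ∃ λ S → IsThreshold (switch G S)

HasInducedSwitchingCopy : ∀ {n m} → Graph n → Graph m → Set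
HasInducedSwitchingCopy {n} {m} G H =
  Σ (Fin m → Fin n) λ f → Injective _≡_ _≡_ f ×
  Σ (VSet m) λ S → ∀ i j → adj G (f i) (f j) xor (S i xor S j) ≡ adj H i j

-- Concrete graphs.
-- 3K₂ on Fin 6: edges {0,1},{2,3},{4,5}.
adj3K2 : Fin 6 → Fin 6 → Bool
adj3K2 zero (suc zero) = true
adj3K2 (suc zero) zero = true
adj3K2 (suc (suc zero)) (suc (suc (suc zero))) = true
adj3K2 (suc (suc (suc zero))) (suc (suc zero)) = true
adj3K2 (suc (suc (suc (suc zero)))) (suc (suc (suc (suc (suc zero))))) = true
adj3K2 (suc (suc (suc (suc (suc zero))))) (suc (suc (suc (suc zero)))) = true
adj3K2 _ _ = false

-- C₅ on Fin 5: edges {i, i+1 mod 5}.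
adjC5 : Fin 5 → Fin 5 → Bool
adjC5 zero (suc zero) = true
adjC5 (suc zero) zero = true
adjC5 (suc zero) (suc (suc zero)) = true
adjC5 (suc (suc zero)) (suc zero) = true
adjC5 (suc (suc zero)) (suc (suc (suc zero))) = true
adjC5 (suc (suc (suc zero))) (suc (suc zero)) = true
adjC5 (suc (suc (suc zero))) (suc (suc (suc (suc zero)))) = true
adjC5 (suc (suc (suc (suc zero)))) (suc (suc (suc zero))) = true
adjC5 (suc (suc (suc (suc zero)))) zero = true
adjC5 zero (suc (suc (suc (suc zero)))) = true
adjC5 _ _ = false

-- C₄ + 2K₁ on Fin 6: 4-cycle 0-1-2-3-0, vertices 4 and 5 isolated.
adjC4K1K1 : Fin 6 → Fin 6 → Bool
adjC4K1K1 zero (suc zero) = true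
adjC4K1K1 (suc zero) zero = true
adjC4K1K1 (suc zero) (suc (suc zero)) = true
adjC4K1K1 (suc (suc zero)) (suc zero) = true
adjC4K1K1 (suc (suc zero)) (suc (suc (suc zero))) = true
adjC4K1K1 (suc (suc (suc zero))) (suc (suc zero)) = true
adjC4K1K1 (suc (suc (suc zero))) zero = true
adjC4K1K1 zero (suc (suc (suc zero))) = true
adjC4K1K1 _ _ = false

open import Relation.Binary.PropositionalEquality using (refl)

sym3K2 : ∀ i j → adj3K2 i j ≡ adj3K2 j i
sym3K2 (zero) (zero) = refl
sym3K2 (zero) (suc (zero)) = refl
sym3K2 (zero) (suc (suc (zero))) = refl
sym3K2 (zero) (suc (suc (suc (zero)))) = refl
sym3K2 (zero) (suc (suc (suc (suc (zero))))) = refl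
sym3K2 (zero) (suc (suc (suc (suc (suc (zero)))))) = refl
sym3K2 (suc (zero)) (zero) = refl
sym3K2 (suc (zero)) (suc (zero)) = refl
sym3K2 (suc (zero)) (suc (suc (zero))) = refl
sym3K2 (suc (zero)) (suc (suc (suc (zero)))) = refl
sym3K2 (suc (zero)) (suc (suc (suc (suc (zero))))) = refl
sym3K2 (suc (zero)) (suc (suc (suc (suc (suc (zero)))))) = refl
sym3K2 (suc (suc (zero))) (zero) = refl
sym3K2 (suc (suc (zero))) (suc (zero)) = refl
sym3K2 (suc (suc (zero))) (suc (suc (zero))) = refl
sym3K2 (suc (suc (zero))) (suc (suc (suc (zero)))) = refl
sym3K2 (suc (suc (zero))) (suc (suc (suc (suc (zero))))) = refl
sym3K2 (suc (suc (zero))) (suc (suc (suc (suc (suc (zero)))))) = refl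
sym3K2 (suc (suc (suc (zero)))) (zero) = refl
sym3K2 (suc (suc (suc (zero)))) (suc (zero)) = refl
sym3K2 (suc (suc (suc (zero)))) (suc (suc (zero))) = refl
sym3K2 (suc (suc (suc (zero)))) (suc (suc (suc (zero)))) = refl
sym3K2 (suc (suc (suc (zero)))) (suc (suc (suc (suc (zero))))) = refl
sym3K2 (suc (suc (suc (zero)))) (suc (suc (suc (suc (suc (zero)))))) = refl
sym3K2 (suc (suc (suc (suc (zero))))) (zero) = refl
sym3K2 (suc (suc (suc (suc (zero))))) (suc (zero)) = refl
sym3K2 (suc (suc (suc (suc (zero))))) (suc (suc (zero))) = refl
sym3K2 (suc (suc (suc (suc (zero))))) (suc (suc (suc (zero)))) = refl
sym3K2 (suc (suc (suc (suc (zero))))) (suc (suc (suc (suc (zero))))) = refl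
sym3K2 (suc (suc (suc (suc (zero))))) (suc (suc (suc (suc (suc (zero)))))) = refl
sym3K2 (suc (suc (suc (suc (suc (zero)))))) (zero) = refl
sym3K2 (suc (suc (suc (suc (suc (zero)))))) (suc (zero)) = refl
sym3K2 (suc (suc (suc (suc (suc (zero)))))) (suc (suc (zero))) = refl
sym3K2 (suc (suc (suc (suc (suc (zero)))))) (suc (suc (suc (zero)))) = refl
sym3K2 (suc (suc (suc (suc (suc (zero)))))) (suc (suc (suc (suc (zero))))) = refl
sym3K2 (suc (suc (suc (suc (suc (zero)))))) (suc (suc (suc (suc (suc (zero)))))) = refl
irr3K2 : ∀ i → adj3K2 i i ≡ false
irr3K2 (zero) = refl
irr3K2 (suc (zero)) = refl
irr3K2 (suc (suc (zero))) = refl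
irr3K2 (suc (suc (suc (zero)))) = refl
irr3K2 (suc (suc (suc (suc (zero))))) = refl
irr3K2 (suc (suc (suc (suc (suc (zero)))))) = refl

symC5 : ∀ i j → adjC5 i j ≡ adjC5 j i
symC5 (zero) (zero) = refl
symC5 (zero) (suc (zero)) = refl
symC5 (zero) (suc (suc (zero))) = refl
symC5 (zero) (suc (suc (suc (zero)))) = refl
symC5 (zero) (suc (suc (suc (suc (zero))))) = refl
symC5 (suc (zero)) (zero) = refl
symC5 (suc (zero)) (suc (zero)) = refl
symC5 (suc (zero)) (suc (suc (zero))) = refl
symC5 (suc (zero)) (suc (suc (suc (zero)))) = refl
symC5 (suc (zero)) (suc (suc (suc (suc (zero))))) = refl
symC5 (suc (suc (zero))) (zero) = refl
symC5 (suc (suc (zero))) (suc (zero)) = refl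
symC5 (suc (suc (zero))) (suc (suc (zero))) = refl
symC5 (suc (suc (zero))) (suc (suc (suc (zero)))) = refl
symC5 (suc (suc (zero))) (suc (suc (suc (suc (zero))))) = refl
symC5 (suc (suc (suc (zero)))) (zero) = refl
symC5 (suc (suc (suc (zero)))) (suc (zero)) = refl
symC5 (suc (suc (suc (zero)))) (suc (suc (zero))) = refl
symC5 (suc (suc (suc (zero)))) (suc (suc (suc (zero)))) = refl
symC5 (suc (suc (suc (zero)))) (suc (suc (suc (suc (zero))))) = refl
symC5 (suc (suc (suc (suc (zero))))) (zero) = refl
symC5 (suc (suc (suc (suc (zero))))) (suc (zero)) = refl
symC5 (suc (suc (suc (suc (zero))))) (suc (suc (zero))) = refl
symC5 (suc (suc (suc (suc (zero))))) (suc (suc (suc (zero)))) = refl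
symC5 (suc (suc (suc (suc (zero))))) (suc (suc (suc (suc (zero))))) = refl
irrC5 : ∀ i → adjC5 i i ≡ false
irrC5 (zero) = refl
irrC5 (suc (zero)) = refl
irrC5 (suc (suc (zero))) = refl
irrC5 (suc (suc (suc (zero)))) = refl
irrC5 (suc (suc (suc (suc (zero))))) = refl

symC4K1K1 : ∀ i j → adjC4K1K1 i j ≡ adjC4K1K1 j i
symC4K1K1 (zero) (zero) = refl
symC4K1K1 (zero) (suc (zero)) = refl
symC4K1K1 (zero) (suc (suc (zero))) = refl
symC4K1K1 (zero) (suc (suc (suc (zero)))) = refl
symC4K1K1 (zero) (suc (suc (suc (suc (zero))))) = refl
symC4K1K1 (zero) (suc (suc (suc (suc (suc (zero)))))) = refl
symC4K1K1 (suc (zero)) (zero) = refl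
symC4K1K1 (suc (zero)) (suc (zero)) = refl
symC4K1K1 (suc (zero)) (suc (suc (zero))) = refl
symC4K1K1 (suc (zero)) (suc (suc (suc (zero)))) = refl
symC4K1K1 (suc (zero)) (suc (suc (suc (suc (zero))))) = refl
symC4K1K1 (suc (zero)) (suc (suc (suc (suc (suc (zero)))))) = refl
symC4K1K1 (suc (suc (zero))) (zero) = refl
symC4K1K1 (suc (suc (zero))) (suc (zero)) = refl
symC4K1K1 (suc (suc (zero))) (suc (suc (zero))) = refl
symC4K1K1 (suc (suc (zero))) (suc (suc (suc (zero)))) = refl
symC4K1K1 (suc (suc (zero))) (suc (suc (suc (suc (zero))))) = refl
symC4K1K1 (suc (suc (zero))) (suc (suc (suc (suc (suc (zero)))))) = refl
symC4K1K1 (suc (suc (suc (zero)))) (zero) = refl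
symC4K1K1 (suc (suc (suc (zero)))) (suc (zero)) = refl
symC4K1K1 (suc (suc (suc (zero)))) (suc (suc (zero))) = refl
symC4K1K1 (suc (suc (suc (zero)))) (suc (suc (suc (zero)))) = refl
symC4K1K1 (suc (suc (suc (zero)))) (suc (suc (suc (suc (zero))))) = refl
symC4K1K1 (suc (suc (suc (zero)))) (suc (suc (suc (suc (suc (zero)))))) = refl
symC4K1K1 (suc (suc (suc (suc (zero))))) (zero) = refl
symC4K1K1 (suc (suc (suc (suc (zero))))) (suc (zero)) = refl
symC4K1K1 (suc (suc (suc (suc (zero))))) (suc (suc (zero))) = refl
symC4K1K1 (suc (suc (suc (suc (zero))))) (suc (suc (suc (zero)))) = refl
symC4K1K1 (suc (suc (suc (suc (zero))))) (suc (suc (suc (suc (zero))))) = refl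
symC4K1K1 (suc (suc (suc (suc (zero))))) (suc (suc (suc (suc (suc (zero)))))) = refl
symC4K1K1 (suc (suc (suc (suc (suc (zero)))))) (zero) = refl
symC4K1K1 (suc (suc (suc (suc (suc (zero)))))) (suc (zero)) = refl
symC4K1K1 (suc (suc (suc (suc (suc (zero)))))) (suc (suc (zero))) = refl
symC4K1K1 (suc (suc (suc (suc (suc (zero)))))) (suc (suc (suc (zero)))) = refl
symC4K1K1 (suc (suc (suc (suc (suc (zero)))))) (suc (suc (suc (suc (zero))))) = refl
symC4K1K1 (suc (suc (suc (suc (suc (zero)))))) (suc (suc (suc (suc (suc (zero)))))) = refl
irrC4K1K1 : ∀ i → adjC4K1K1 i i ≡ false
irrC4K1K1 (zero) = refl
irrC4K1K1 (suc (zero)) = refl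
irrC4K1K1 (suc (suc (zero))) = refl
irrC4K1K1 (suc (suc (suc (zero)))) = refl
irrC4K1K1 (suc (suc (suc (suc (zero))))) = refl
irrC4K1K1 (suc (suc (suc (suc (suc (zero)))))) = refl

3K2 : Graph 6
3K2 = record { adj = adj3K2 ; sym = sym3K2 ; irrefl = irr3K2 }

C5 : Graph 5
C5 = record { adj = adjC5 ; sym = symC5 ; irrefl = irrC5 }

C4+2K1 : Graph 6
C4+2K1 = record { adj = adjC4K1K1 ; sym = symC4K1K1 ; irrefl = irrC4K1K1 }

module Submission where

-- The central notion is an alternating 4-cycle: edges ux, wy and non-edges
-- uy, wx (an induced 2K₂, P₄ or C₄); a graph is threshold iff it has none.
-- Necessity: every switching of each forbidden graph has one (checked by
-- evaluation), and an induced copy carries it into every switching of G.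
-- Sufficiency: switch so that a vertex a is isolated.  Then an induced P₄
-- yields a switched C₅, and a C₄ becomes a 2K₂ of the complement on V - a.
-- For an induced 2K₂ pq, rs, the vertices near p and the far ones are
-- separated and each free of alternating 4-cycles; switching at the far
-- vertices that dominate a far neighbour (vicinal preorder) removes them all.

open import Defs hiding (sym)
open import Data.Nat using (ℕ; zero; suc; s≤s)
open import Data.Fin using (Fin; zero; suc; _<_; #_)
open import Data.Fin.Properties using (_≟_; <-cmp; any?; all?)
open import Data.Fin.Subset.Properties using (anySubset?)
open import Data.Bool using (Bool; true; false; not; _xor_; if_then_else_)
open import Data.Bool.Properties
  using (xor-assoc; xor-comm; xor-same; xor-identityʳ; not-distribˡ-xor; not-involutive; ¬-not;
         xor-∧-commutativeRing)
  renaming (_≟_ to _≟ᵇ_)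
open import Data.Vec using (_∷_; []; lookup; tabulate)
open import Data.Vec.Properties using (lookup∘tabulate)
open import Data.List using (List; []; _∷_; allFin)
open import Data.List.Membership.Propositional using (_∈_)
open import Data.List.Membership.Propositional.Properties using (∈-allFin)
open import Data.List.Relation.Unary.Any using (here; there)
open import Data.Product using (Σ; ∃; _×_; _,_; proj₁; proj₂)
open import Data.Sum using (_⊎_; inj₁; inj₂)
open import Data.Unit using (⊤)
open import Data.Empty using (⊥; ⊥-elim)
open import Function using (_∘_)
open import Function.Bundles using (_⇔_; mk⇔)
open import Function.Definitions using (Injective)
open import Algebra.Bundles using (CommutativeRing)
open import Algebra.Properties.CommutativeSemigroup
  (CommutativeRing.+-commutativeSemigroup xor-∧-commutativeRing) using (interchange)
open import Relation.Binary.Definitions using (tri<; tri≈; tri>)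
open import Relation.Nullary using (¬_; Dec; yes; no; does)
open import Relation.Nullary.Decidable
  using (_×-dec_; _⊎-dec_; ¬?; map′; dec-true; dec-false; decidable-stable;
         toWitness; toWitnessFalse; True; False)
open import Relation.Binary.PropositionalEquality
  using (_≡_; _≢_; refl; sym; trans; cong; cong₂; module ≡-Reasoning)

clash : ∀ {b} → b ≡ true → b ≡ false → ⊥
clash refl ()

true-witness : ∀ {A : Set} (a? : Dec A) → does a? ≡ true → A
true-witness (yes a) _ = a
true-witness (no _) ()

not-flip : ∀ {b c d} → c ≡ not b → c ≡ d → b ≡ not d
not-flip {true}  refl refl = refl
not-flip {false} refl refl = refl

Adj : ℕ → Set
Adj n = Fin n → Fin n → Bool

_≗₂_ : ∀ {n} → Adj n → Adj n → Set
k ≗₂ k' = ∀ i j → k i j ≡ k' i j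

Symmetric : ∀ {n} → Adj n → Set
Symmetric k = ∀ i j → k i j ≡ k j i

Loopless : ∀ {n} → Adj n → Set
Loopless k = ∀ i → k i i ≡ false

restrict : ∀ {n m} → Adj n → (Fin m → Fin n) → Adj m
restrict k f i j = k (f i) (f j)

-- Switching w.r.t. S; the Defs operation `switchAdj G S` is `switchA (adj G) S`.
switchA : ∀ {n} → Adj n → VSet n → Adj n
switchA k S i j = k i j xor (S i xor S j)

_⊕_ : ∀ {n} → VSet n → VSet n → VSet n
(S ⊕ T) i = S i xor T i

edge-distinct : ∀ {n} {k : Adj n} → Loopless k → ∀ {i j} → k i j ≡ true → i ≢ j
edge-distinct kl {i} e refl = clash e (kl i)

switch-value : ∀ {n} {k : Adj n} {S : VSet n} {i j b c d} → k i j ≡ b → S i ≡ c → S j ≡ d →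
               switchA k S i j ≡ b xor (c xor d)
switch-value e ci cj = cong₂ _xor_ e (cong₂ _xor_ ci cj)

switch-cong : ∀ {n} {k k' : Adj n} → k ≗₂ k' → ∀ S → switchA k S ≗₂ switchA k' S
switch-cong e S i j = cong (_xor (S i xor S j)) (e i j)

switch-ext : ∀ {n} (k : Adj n) {S S' : VSet n} → (∀ i → S i ≡ S' i) → switchA k S ≗₂ switchA k S'
switch-ext k {S} {S'} e i j = cong (λ t → k i j xor t) (trans (cong (_xor S j) (e i)) (cong (S' i xor_) (e j)))

switch-twice : ∀ {n} (k : Adj n) S T → switchA (switchA k S) T ≗₂ switchA k (S ⊕ T)
switch-twice k S T i j = begin
  (k i j xor (S i xor S j)) xor (T i xor T j)   ≡⟨ xor-assoc (k i j) _ _ ⟩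
  k i j xor ((S i xor S j) xor (T i xor T j))   ≡⟨ cong (k i j xor_) (interchange (S i) (S j) (T i) (T j)) ⟩
  k i j xor ((S i xor T i) xor (S j xor T j))   ∎
  where open ≡-Reasoning

switch-empty : ∀ {n} (k : Adj n) → switchA k (λ _ → false) ≗₂ k
switch-empty k i j = xor-identityʳ (k i j)

switch-involutive : ∀ {n} (k : Adj n) S → switchA (switchA k S) S ≗₂ k
switch-involutive k S i j = trans (switch-twice k S S i j)
  (trans (switch-ext k (λ l → xor-same (S l)) i j) (switch-empty k i j))

switch-transpose : ∀ {n} {k x : Adj n} S → switchA k S ≗₂ x → k ≗₂ switchA x S
switch-transpose {k = k} S e i j = trans (sym (switch-involutive k S i j)) (switch-cong e S i j)

switch-symmetric : ∀ {n} {k : Adj n} → Symmetric k → ∀ S → Symmetric (switchA k S)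
switch-symmetric ks S i j = cong₂ _xor_ (ks i j) (xor-comm (S i) (S j))

switch-loopless : ∀ {n} {k : Adj n} → Loopless k → ∀ S → Loopless (switchA k S)
switch-loopless {k = k} kl S i = trans (cong (_xor (S i xor S i)) (kl i)) (xor-same (S i))

-- Unfolding the definitions,
-- `HasInducedSwitchingCopy G H` is `Copy (adj G) (adj H)`.
Copy : ∀ {n m} → Adj n → Adj m → Set
Copy {n} {m} k x =
  Σ (Fin m → Fin n) λ f → Injective _≡_ _≡_ f × Σ (VSet m) λ S → switchA (restrict k f) S ≗₂ x

copy-source : ∀ {n m} {k k' : Adj n} {x : Adj m} → k ≗₂ k' → Copy k x → Copy k' x
copy-source e (f , inj , S , eq) =
  f , inj , S , λ i j → trans (sym (switch-cong (λ i j → e (f i) (f j)) S i j)) (eq i j)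

copy-unswitch : ∀ {n m} {k : Adj n} {x : Adj m} T → Copy (switchA k T) x → Copy k x
copy-unswitch {k = k} T (f , inj , S , eq) =
  f , inj , (T ∘ f) ⊕ S , λ i j → trans (sym (switch-twice (restrict k f) (T ∘ f) S i j)) (eq i j)

copy-compose : ∀ {n m l} {k : Adj n} {x : Adj m} {y : Adj l} → Copy k x → Copy x y → Copy k y
copy-compose {k = k} {x} {y} (f , f-inj , S , eS) (g , g-inj , R , eR) =
  f ∘ g , g-inj ∘ f-inj , (S ∘ g) ⊕ R , λ i j → begin
    switchA (restrict k (f ∘ g)) ((S ∘ g) ⊕ R) i j
      ≡⟨ sym (switch-twice (restrict k (f ∘ g)) (S ∘ g) R i j) ⟩
    switchA (restrict (switchA (restrict k f) S) g) R i j
      ≡⟨ switch-cong (λ i j → eS (g i) (g j)) R i j ⟩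
    switchA (restrict x g) R i j
      ≡⟨ eR i j ⟩
    y i j ∎
  where open ≡-Reasoning

copy-switching : ∀ {n m} {k : Adj n} {x : Adj m} ((f , _ , R , _) : Copy k x) →
                 ∀ T → switchA (restrict k f) T ≗₂ switchA x (R ⊕ T)
copy-switching {k = k} {x} (f , _ , R , eq) T i j =
  trans (switch-cong (switch-transpose {k = restrict k f} R eq) T i j) (switch-twice x R T i j)

≗₂? : ∀ {m} (a b : Adj m) → Dec (a ≗₂ b)
≗₂? a b = all? λ i → all? λ j → a i j ≟ᵇ b i j

copy-by-evaluation : ∀ {n m} (k : Adj n) (x : Adj m) (g : Fin m → Fin n) (g⁻¹ : Fin n → Fin m) (R : VSet m) →
  {True (all? λ i → g⁻¹ (g i) ≟ i)} → {True (≗₂? (switchA (restrict k g) R) x)} → Copy k x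
copy-by-evaluation k x g g⁻¹ R {inverse} {equal} = g , injective , R , toWitness equal
  where
  injective : Injective _≡_ _≡_ g
  injective {i} {j} e = trans (sym (toWitness inverse i)) (trans (cong g⁻¹ e) (toWitness inverse j))

-- `Upper m P` collects a proof of P i j for every pair i < j, as a nested
-- tuple (row by row), so that facts about a concrete tuple of vertices can be
-- written down directly.
Row : (m : ℕ) → (Fin m → Set) → Set
Row zero    Q = ⊤
Row (suc m) Q = Q zero × Row m (Q ∘ suc)

Upper : (m : ℕ) → (Fin m → Fin m → Set) → Set
Upper zero    P = ⊤
Upper (suc m) P = Row m (P zero ∘ suc) × Upper m (λ i j → P (suc i) (suc j))

row-lookup : ∀ {m Q} → Row m Q → ∀ j → Q j
row-lookup (q , _)  zero    = q
row-lookup (_ , qs) (suc j) = row-lookup qs j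

upper-lookup : ∀ {m P} → Upper m P → ∀ {i j} → i < j → P i j
upper-lookup {suc m} (r , _) {zero}  {suc j} _         = row-lookup r j
upper-lookup {suc m} (_ , u) {suc i} {suc j} (s≤s i<j) = upper-lookup u i<j

upper-complete : ∀ {n m} {k : Adj n} → Symmetric k → Loopless k → (M : Graph m) (v : Fin m → Fin n) →
                 Upper m (λ i j → restrict k v i j ≡ adj M i j) → restrict k v ≗₂ adj M
upper-complete ks kl M v facts i j with <-cmp i j
... | tri< i<j _ _ = upper-lookup facts i<j
... | tri≈ _ refl _ = trans (kl (v i)) (sym (irrefl M i))
... | tri> _ _ j<i = trans (ks (v i) (v j)) (trans (upper-lookup facts j<i) (Graph.sym M j i))

-- Twins (equal rows) are the only vertices a realising tuple may identify;
-- a tuple is separated if it is injective on twin pairs.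
Twins : ∀ {m} → Adj m → Fin m → Fin m → Set
Twins M i j = ∀ l → M i l ≡ M j l

twins? : ∀ {m} (M : Adj m) i j → Dec (Twins M i j)
twins? M i j = all? λ l → M i l ≟ᵇ M j l

Separated : ∀ {n m} → Adj m → (Fin m → Fin n) → Set
Separated {m = m} M v = Upper m (λ i j → if does (twins? M i j) then v i ≢ v j else ⊤)

guard-elim : ∀ {A B : Set} (d : Dec A) → (if does d then B else ⊤) → A → B
guard-elim (yes _)  b _ = b
guard-elim (no ¬a) _ a = ⊥-elim (¬a a)

-- Vertices of a realising tuple with the same image are twins, so the guard separates them.
guarded-pair : ∀ {n m} {k : Adj n} {M : Adj m} {v : Fin m → Fin n} → restrict k v ≗₂ M →
               ∀ {i j} → (if does (twins? M i j) then v i ≢ v j else ⊤) → v i ≢ v j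
guarded-pair {k = k} {M} {v} real {i} {j} guard e = guard-elim (twins? M i j) guard
  (λ l → trans (sym (real i l)) (trans (cong (λ z → k z (v l)) e) (real j l))) e

realisation-injective : ∀ {n m} {k : Adj n} {M : Adj m} {v : Fin m → Fin n} →
  restrict k v ≗₂ M → Separated M v → Injective _≡_ _≡_ v
realisation-injective {k = k} {M} {v} real sep {i} {j} vi≡vj with <-cmp i j
... | tri< i<j _ _ = ⊥-elim (guarded-pair {k = k} {M} {v} real (upper-lookup sep i<j) vi≡vj)
... | tri≈ _ i≡j _ = i≡j
... | tri> _ _ j<i = ⊥-elim (guarded-pair {k = k} {M} {v} real (upper-lookup sep j<i) (sym vi≡vj))

pattern-copy : ∀ {n m} {k : Adj n} → Symmetric k → Loopless k →
  (X : Graph m) (R : VSet m) (v : Fin m → Fin n) →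
  Upper m (λ i j → k (v i) (v j) ≡ switchAdj X R i j) → Separated (switchAdj X R) v → Copy k (adj X)
pattern-copy {k = k} ks kl X R v facts sep =
  v , realisation-injective {k = k} real sep , R ,
  λ i j → trans (switch-cong real R i j) (switch-involutive (adj X) R i j)
  where
  real : restrict k v ≗₂ switchAdj X R
  real = upper-complete ks kl (switch X R) v facts

-- Edges ux, wy and non-edges uy, wx: an induced 2K₂, P₄ or C₄ (depending on
-- uw and xy).  The remaining distinctness conditions follow from the edges.
record AltCycle {n} (k : Adj n) (u x w y : Fin n) : Set where
  constructor alt
  field
    ux  : k u x ≡ true
    wy  : k w y ≡ true
    uy  : k u y ≡ false
    wx  : k w x ≡ false
    u≢y : u ≢ y
    w≢x : w ≢ x

HasAltCycle : ∀ {n} → Adj n → Set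
HasAltCycle k = ∃ λ u → ∃ λ x → ∃ λ w → ∃ λ y → AltCycle k u x w y

AltFreeOn : ∀ {n} → VSet n → Adj n → Set
AltFreeOn U k =
  ∀ {u x w y} → U u ≡ true → U x ≡ true → U w ≡ true → U y ≡ true → ¬ AltCycle k u x w y

AltFree : ∀ {n} → Adj n → Set
AltFree k = ∀ {u x w y} → ¬ AltCycle k u x w y

alt? : ∀ {n} (k : Adj n) u x w y → Dec (AltCycle k u x w y)
alt? k u x w y =
  map′ (λ (ux , wy , uy , wx , u≢y , w≢x) → alt ux wy uy wx u≢y w≢x)
       (λ (alt ux wy uy wx u≢y w≢x) → ux , wy , uy , wx , u≢y , w≢x)
       ((k u x ≟ᵇ true) ×-dec (k w y ≟ᵇ true) ×-dec (k u y ≟ᵇ false) ×-dec (k w x ≟ᵇ false)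
         ×-dec ¬? (u ≟ y) ×-dec ¬? (w ≟ x))

hasAltCycle? : ∀ {n} (k : Adj n) → Dec (HasAltCycle k)
hasAltCycle? k = any? λ u → any? λ x → any? λ w → any? λ y → alt? k u x w y

alt-swap : ∀ {n} {k : Adj n} {u x w y} → AltCycle k u x w y → AltCycle k w y u x
alt-swap (alt ux wy uy wx u≢y w≢x) = alt wy ux wx uy w≢x u≢y

alt-reverse : ∀ {n} {k : Adj n} → Symmetric k → ∀ {u x w y} → AltCycle k u x w y → AltCycle k x u y w
alt-reverse ks {u} {x} {w} {y} (alt ux wy uy wx u≢y w≢x) =
  alt (trans (ks x u) ux) (trans (ks y w) wy) (trans (ks x w) wx) (trans (ks y u) uy)
      (w≢x ∘ sym) (u≢y ∘ sym)

alt-cong : ∀ {n} {k k' : Adj n} → k ≗₂ k' → ∀ {u x w y} → AltCycle k u x w y → AltCycle k' u x w y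
alt-cong e {u} {x} {w} {y} (alt ux wy uy wx u≢y w≢x) =
  alt (trans (sym (e u x)) ux) (trans (sym (e w y)) wy) (trans (sym (e u y)) uy) (trans (sym (e w x)) wx) u≢y w≢x

alt-along : ∀ {n m} {k : Adj n} {f : Fin m → Fin n} → Injective _≡_ _≡_ f →
            ∀ {u x w y} → AltCycle (restrict k f) u x w y → AltCycle k (f u) (f x) (f w) (f y)
alt-along inj (alt ux wy uy wx u≢y w≢x) = alt ux wy uy wx (u≢y ∘ inj) (w≢x ∘ inj)

alt-complement : ∀ {n} {k k' : Adj n} → Loopless k' → (∀ {i j} → i ≢ j → k' i j ≡ not (k i j)) →
                 ∀ {u x w y} → AltCycle k' u x w y → AltCycle k u y w x
alt-complement {k = k} kl' co {u} {x} {w} {y} (alt ux wy uy wx u≢y w≢x) =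
  alt (not-flip (co u≢y) uy) (not-flip (co w≢x) wx) (not-flip (co u≢x) ux) (not-flip (co w≢y) wy) u≢x w≢y
  where
  u≢x : u ≢ x
  u≢x = edge-distinct kl' ux
  w≢y : w ≢ y
  w≢y = edge-distinct kl' wy

Mixed : ∀ {n} → Adj n → VSet n → Fin n → Set
Mixed k U v =
  (∃ λ w → U w ≡ true × w ≢ v × k v w ≡ true) × (∃ λ w → U w ≡ true × w ≢ v × k v w ≡ false)

mixed-not-threshold : ∀ {n} {k : Adj n} (U : VSet n) {u} → U u ≡ true →
                      (∀ {v} → U v ≡ true → Mixed k U v) → ¬ IsThresholdAdj k
mixed-not-threshold U Uu mixed th with th U (_ , Uu)
... | v , Uv , inj₁ isolated with mixed Uv
...   | (w , Uw , w≢v , kvw) , _ = clash kvw (isolated w Uw w≢v)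
mixed-not-threshold U Uu mixed th | v , Uv , inj₂ universal with mixed Uv
...   | _ , (w , Uw , w≢v , kvw) = clash (universal w Uw w≢v) kvw

-- The four vertices of an alternating 4-cycle are all mixed among themselves.
alt-not-threshold : ∀ {n} (H : Graph n) {u x w y} → AltCycle (adj H) u x w y → ¬ IsThreshold H
alt-not-threshold H {u} {x} {w} {y} (alt ux wy uy wx u≢y w≢x) =
  mixed-not-threshold Q {u} Q-u mixed
  where
  k : Adj _
  k = adj H
  member? : ∀ z → Dec (z ≡ u ⊎ z ≡ x ⊎ z ≡ w ⊎ z ≡ y)
  member? z = (z ≟ u) ⊎-dec (z ≟ x) ⊎-dec (z ≟ w) ⊎-dec (z ≟ y)
  Q : VSet _
  Q z = does (member? z)
  Q-u : Q u ≡ true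
  Q-u = dec-true (member? u) (inj₁ refl)
  Q-x : Q x ≡ true
  Q-x = dec-true (member? x) (inj₂ (inj₁ refl))
  Q-w : Q w ≡ true
  Q-w = dec-true (member? w) (inj₂ (inj₂ (inj₁ refl)))
  Q-y : Q y ≡ true
  Q-y = dec-true (member? y) (inj₂ (inj₂ (inj₂ refl)))
  symm : ∀ {i j b} → k i j ≡ b → k j i ≡ b
  symm {i} {j} e = trans (Graph.sym H j i) e
  u≢x : u ≢ x
  u≢x = edge-distinct (irrefl H) ux
  w≢y : w ≢ y
  w≢y = edge-distinct (irrefl H) wy
  mixed : ∀ {v} → Q v ≡ true → Mixed k Q v
  mixed {v} Qv with true-witness (member? v) Qv
  ... | inj₁ refl               = (x , Q-x , u≢x ∘ sym , ux) , (y , Q-y , u≢y ∘ sym , uy)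
  ... | inj₂ (inj₁ refl)        = (u , Q-u , u≢x , symm ux) , (w , Q-w , w≢x , symm wx)
  ... | inj₂ (inj₂ (inj₁ refl)) = (y , Q-y , w≢y ∘ sym , wy) , (x , Q-x , w≢x ∘ sym , wx)
  ... | inj₂ (inj₂ (inj₂ refl)) = (w , Q-w , w≢y , symm wy) , (u , Q-u , u≢y , symm uy)

-- If k has no alternating 4-cycle inside U, the
-- neighbourhoods of the vertices of U are nested; a vertex with the largest
-- neighbourhood is universal in U unless one of its non-neighbours exists,
-- and such a non-neighbour is isolated in U.
module Vicinal {n} (k : Adj n) (ks : Symmetric k) (U : VSet n) (free : AltFreeOn U k) where

  _≼_ : Fin n → Fin n → Set
  w ≼ v = ∀ {z} → U z ≡ true → z ≢ v → z ≢ w → k w z ≡ true → k v z ≡ true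

  Escape : Fin n → Fin n → Fin n → Set
  Escape w v z = U z ≡ true × z ≢ v × z ≢ w × k w z ≡ true × k v z ≡ false

  ≼-or-escape : ∀ w v → w ≼ v ⊎ ∃ (Escape w v)
  ≼-or-escape w v with any? (λ z →
    (U z ≟ᵇ true) ×-dec ¬? (z ≟ v) ×-dec ¬? (z ≟ w) ×-dec (k w z ≟ᵇ true) ×-dec (k v z ≟ᵇ false))
  ... | yes escape = inj₂ escape
  ... | no no-escape =
    inj₁ λ {z} Uz z≢v z≢w kwz → ¬-not λ kvz → no-escape (z , Uz , z≢v , z≢w , kwz , kvz)

  _≼?_ : ∀ w v → Dec (w ≼ v)
  w ≼? v with ≼-or-escape w v
  ... | inj₁ w≼v = yes w≼v
  ... | inj₂ (z , Uz , z≢v , z≢w , kwz , kvz) = no λ w≼v → clash (w≼v Uz z≢v z≢w kwz) kvz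

  ≼-refl : ∀ {w} → w ≼ w
  ≼-refl _ _ _ kwz = kwz

  -- An escape from w ≼ v forces v ≼ w, or else w z v z' is an alternating 4-cycle.
  ≼-total : ∀ {v w} → U v ≡ true → U w ≡ true → w ≼ v ⊎ v ≼ w
  ≼-total {v} {w} Uv Uw with ≼-or-escape w v
  ... | inj₁ w≼v = inj₁ w≼v
  ... | inj₂ (z , Uz , z≢v , z≢w , kwz , kvz) = inj₂ v≼w
    where
    v≼w : v ≼ w
    v≼w {z'} Uz' z'≢w z'≢v kvz' with k w z' in kwz'
    ... | true  = refl
    ... | false = ⊥-elim (free Uw Uz Uv Uz' (alt kwz kvz' kwz' kvz (z'≢w ∘ sym) (z≢v ∘ sym)))

  ≼-trans : ∀ {w c c'} → U w ≡ true → U c ≡ true → U c' ≡ true → w ≼ c → c ≼ c' → w ≼ c'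
  ≼-trans {w} {c} {c'} Uw Uc Uc' w≼c c≼c' {z} Uz z≢c' z≢w kwz with z ≟ c
  ... | no z≢c = c≼c' Uz z≢c' z≢c (w≼c Uz z≢c z≢w kwz)
  ... | yes refl with w ≟ c'
  ...   | yes refl = kwz
  ...   | no w≢c' = trans (ks c' z) (w≼c Uc' (z≢c' ∘ sym) (w≢c' ∘ sym) (trans (ks w c') kc'w))
    where
    kc'w : k c' w ≡ true
    kc'w = c≼c' Uw w≢c' (z≢w ∘ sym) (trans (ks z w) kwz)

  upper-bound : (l : List (Fin n)) → ∀ {c} → U c ≡ true →
                ∃ λ v → U v ≡ true × (∀ {w} → w ∈ l → U w ≡ true → w ≼ v)
  upper-bound [] {c} Uc = c , Uc , λ ()
  upper-bound (w ∷ l) Uc with upper-bound l Uc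
  ... | v , Uv , below with U w in Uw
  ...   | false = v , Uv , λ { (here refl) Uw' → ⊥-elim (clash Uw' Uw) ; (there w'∈l) → below w'∈l }
  ...   | true with ≼-total Uv Uw
  ...     | inj₁ w≼v = v , Uv , λ { (here refl) _ → w≼v ; (there w'∈l) → below w'∈l }
  ...     | inj₂ v≼w = w , Uw , λ
    { (here refl) _ → ≼-refl
    ; (there w'∈l) Uw' → ≼-trans Uw' Uv Uw (below w'∈l Uw') v≼w }

  isolated-or-universal : (∃ λ u → U u ≡ true) →
    ∃ λ v → U v ≡ true ×
      ((∀ w → U w ≡ true → w ≢ v → k v w ≡ false) ⊎ (∀ w → U w ≡ true → w ≢ v → k v w ≡ true))
  isolated-or-universal (u , Uu) with upper-bound (allFin n) Uu
  ... | v , Uv , below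
    with any? (λ w → (U w ≟ᵇ true) ×-dec ¬? (w ≟ v) ×-dec (k v w ≟ᵇ false))
  ...   | no no-non-neighbour =
          v , Uv , inj₂ λ w Uw w≢v → ¬-not λ kvw → no-non-neighbour (w , Uw , w≢v , kvw)
  ...   | yes (w , Uw , w≢v , kvw) = w , Uw , inj₁ w-isolated
    where
    -- a neighbour z of w would be a neighbour of v (w ≼ v), and then w a neighbour of v (z ≼ v)
    w-isolated : ∀ z → U z ≡ true → z ≢ w → k w z ≡ false
    w-isolated z Uz z≢w with k w z in kwz | z ≟ v
    ... | false | _        = refl
    ... | true  | yes refl = ⊥-elim (clash (trans (ks v w) kwz) kvw)
    ... | true  | no z≢v   =
          ⊥-elim (clash (below (∈-allFin z) Uz Uw w≢v (z≢w ∘ sym) (trans (ks z w) kwz)) kvw)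

alt-free→threshold : ∀ {n} {k : Adj n} → Symmetric k → AltFree k → IsThresholdAdj k
alt-free→threshold {k = k} ks free U = Vicinal.isolated-or-universal k ks U (λ _ _ _ _ → free)

threshold-cong : ∀ {n} {k k' : Adj n} → k ≗₂ k' → IsThresholdAdj k → IsThresholdAdj k'
threshold-cong e th U nonempty with th U nonempty
... | v , Uv , inj₁ isolated  = v , Uv , inj₁ λ w Uw w≢v → trans (sym (e v w)) (isolated w Uw w≢v)
... | v , Uv , inj₂ universal = v , Uv , inj₂ λ w Uw w≢v → trans (sym (e v w)) (universal w Uw w≢v)

-- Every switching of X has an alternating 4-cycle.  For a concrete X this is
-- checked by evaluation over all 2^m switching sets (as subsets `Vec Bool m`).
every-switching-alt : ∀ {m} (X : Graph m) →
  {False (anySubset? λ V → ¬? (hasAltCycle? (switchAdj X (lookup V))))} →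
  ∀ R → HasAltCycle (switchAdj X R)
every-switching-alt X {none} R
  with decidable-stable (hasAltCycle? _) (λ no-cycle → toWitnessFalse none (tabulate R , no-cycle))
... | u , x , w , y , c = u , x , w , y , alt-cong (switch-ext (adj X) (lookup∘tabulate R)) c

switching-threshold→no-copy : ∀ {n m} (G : Graph n) (X : Graph m) → (∀ R → HasAltCycle (switchAdj X R)) →
                              SwitchingThreshold G → ¬ HasInducedSwitchingCopy G X
switching-threshold→no-copy G X cycles (S , threshold) copy@(f , inj , R , _)
  with cycles (R ⊕ (S ∘ f))
... | u , x , w , y , c =
  alt-not-threshold (switch G S)
    (alt-along {k = switchAdj G S} inj
      (alt-cong (λ i j → sym (copy-switching {k = adj G} copy (S ∘ f) i j)) c)) threshold

record CopyFree {n} (k : Adj n) : Set where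
  field
    no-3K2    : ¬ Copy k adj3K2
    no-C5     : ¬ Copy k adjC5
    no-C4+2K1 : ¬ Copy k adjC4K1K1

copy-free-switch : ∀ {n} {k : Adj n} → CopyFree k → ∀ T → CopyFree (switchA k T)
copy-free-switch {k = k} free T = record
  { no-3K2    = no-3K2 ∘ copy-unswitch {k = k} T
  ; no-C5     = no-C5 ∘ copy-unswitch {k = k} T
  ; no-C4+2K1 = no-C4+2K1 ∘ copy-unswitch {k = k} T
  }
  where open CopyFree free

module Configurations {n} (k : Adj n) (ks : Symmetric k) (kl : Loopless k)
  (a : Fin n) (isolated : ∀ x → k a x ≡ false) (free : CopyFree k) where
  open CopyFree free

  flip-edge : ∀ {i j b} → k i j ≡ b → k j i ≡ b
  flip-edge {i} {j} e = trans (ks j i) e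

  off-a : ∀ {x y} → k x y ≡ true → x ≢ a
  off-a xy refl = clash xy (isolated _)

  -- An induced path p–m–x–y plus the isolated vertex is C₅ switched at {p, y}.
  no-P4 : ∀ {p m x y} → k p m ≡ true → k m x ≡ true → k x y ≡ true →
          k p x ≡ false → k p y ≡ false → k m y ≡ false → ⊥
  no-P4 {p} {m} {x} {y} pm mx xy px py my = no-C5
    (pattern-copy ks kl C5 (lookup (false ∷ true ∷ false ∷ false ∷ true ∷ []))
                  (lookup (a ∷ p ∷ x ∷ m ∷ y ∷ []))
      ( (isolated p , isolated x , isolated m , isolated y , _)
      , (px , pm , py , _) , (flip-edge mx , xy , _) , (my , _) , _ , _ )
      _)

  -- A vertex c adjacent to the four vertices of an induced 2K₂ pq, rs, plus the
  -- isolated vertex, is 3K₂ switched at {c}.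
  no-butterfly : ∀ {c p q r s} → k c p ≡ true → k c q ≡ true → k c r ≡ true → k c s ≡ true →
                 k p q ≡ true → k r s ≡ true →
                 k p r ≡ false → k p s ≡ false → k q r ≡ false → k q s ≡ false → ⊥
  no-butterfly {c} {p} {q} {r} {s} cp cq cr cs pq rs pr ps qr qs = no-3K2
    (pattern-copy ks kl 3K2 (lookup (false ∷ true ∷ false ∷ false ∷ false ∷ false ∷ []))
                  (lookup (a ∷ c ∷ p ∷ q ∷ r ∷ s ∷ []))
      ( (isolated c , isolated p , isolated q , isolated r , isolated s , _)
      , (cp , cq , cr , cs , _) , (pq , pr , ps , _) , (qr , qs , _) , (rs , _) , _ , _ )
      _)

  -- Next to the isolated vertex an alternating 4-cycle is not a P₄: its
  -- diagonals uw, xy are both edges (a C₄) or both non-edges (a 2K₂).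
  alt-diagonals : ∀ {u x w y} → AltCycle k u x w y → k u w ≡ k x y
  alt-diagonals {u} {x} {w} {y} (alt ux wy uy wx _ _) with k u w in uw | k x y in xy
  ... | true  | true  = refl
  ... | false | false = refl
  ... | true  | false = ⊥-elim (no-P4 (flip-edge ux) uw wy (flip-edge wx) xy uy)
  ... | false | true  = ⊥-elim (no-P4 ux xy (flip-edge wy) uy uw (flip-edge wx))

  -- An alternating 4-cycle inside P, next to an edge zz' (z ≠ a) with no edges
  -- to P, is impossible: a 2K₂ would give 3K₂, a C₄ would give C₄ + 2K₁ with z and a.
  alt-beside-edge : (P : Fin n → Set) → ∀ {u x w y z z'} → AltCycle k u x w y →
                    P u → P x → P w → P y → k z z' ≡ true → z ≢ a →
                    (∀ {t} → P t → k z t ≡ false) → (∀ {t} → P t → k z' t ≡ false) → ⊥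
  alt-beside-edge P {u} {x} {w} {y} {z} {z'} c@(alt ux wy uy wx u≢y w≢x) Pu Px Pw Py zz' z≢a zP z'P
    with k u w in uw | k x y in xy | alt-diagonals c
  ... | true  | true  | _ = no-C4+2K1
    (pattern-copy ks kl C4+2K1 (λ _ → false) (lookup (u ∷ x ∷ y ∷ w ∷ z ∷ a ∷ []))
      ( (ux , uy , uw , flip-edge (zP Pu) , flip-edge (isolated u) , _)
      , (xy , flip-edge wx , flip-edge (zP Px) , flip-edge (isolated x) , _)
      , (flip-edge wy , flip-edge (zP Py) , flip-edge (isolated y) , _)
      , (flip-edge (zP Pw) , flip-edge (isolated w) , _)
      , (flip-edge (isolated z) , _) , _ , _ )
      ((_ , u≢y , _) , (_ , w≢x ∘ sym , _) , _ , _ , (z≢a , _) , _ , _))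
  ... | false | false | _ = no-3K2
    (pattern-copy ks kl 3K2 (λ _ → false) (lookup (z ∷ z' ∷ u ∷ x ∷ w ∷ y ∷ []))
      ( (zz' , zP Pu , zP Px , zP Pw , zP Py , _)
      , (z'P Pu , z'P Px , z'P Pw , z'P Py , _)
      , (ux , uw , uy , _) , (flip-edge wx , xy , _) , (wy , _) , _ , _ )
      _)
  ... | true  | false | ()
  ... | false | true  | ()

-- The main construction: next to an isolated vertex a, an induced 2K₂ pq, rs
-- lets us switch away every alternating 4-cycle.
module TwoK2 {n} (k : Adj n) (ks : Symmetric k) (kl : Loopless k)
  (a : Fin n) (isolated : ∀ x → k a x ≡ false) (free : CopyFree k)
  {p q r s : Fin n} (pq : k p q ≡ true) (rs : k r s ≡ true)
  (pr : k p r ≡ false) (ps : k p s ≡ false) (qr : k q r ≡ false) (qs : k q s ≡ false) where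

  open Configurations k ks kl a isolated free

  Near : Fin n → Set
  Near x = x ≡ p ⊎ k p x ≡ true ⊎ ∃ λ m → k p m ≡ true × k m x ≡ true

  near? : ∀ x → Dec (Near x)
  near? x = (x ≟ p) ⊎-dec (k p x ≟ᵇ true) ⊎-dec any? (λ m → (k p m ≟ᵇ true) ×-dec (k m x ≟ᵇ true))

  near-p : Near p
  near-p = inj₁ refl

  near-q : Near q
  near-q = inj₂ (inj₁ pq)

  -- No edge leaves the near set: an edge xy with x at distance 2 (via m) and y
  -- not near would be an induced P₄ p–m–x–y.
  near-closed : ∀ {x y} → Near x → ¬ Near y → k x y ≡ false
  near-closed {x} {y} nx ¬ny with k x y in xy
  ... | false = refl
  ... | true with nx
  ...   | inj₁ refl = ⊥-elim (¬ny (inj₂ (inj₁ xy)))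
  ...   | inj₂ (inj₁ px) = ⊥-elim (¬ny (inj₂ (inj₂ (x , px , xy))))
  ...   | inj₂ (inj₂ (m , pm , mx)) with k p x in px
  ...     | true  = ⊥-elim (¬ny (inj₂ (inj₂ (x , px , xy))))
  ...     | false = ⊥-elim (no-P4 pm mx xy px (¬-not (¬ny ∘ inj₂ ∘ inj₁))
                                       (¬-not λ my → ¬ny (inj₂ (inj₂ (m , pm , my)))))

  Far : Fin n → Set
  Far x = x ≢ a × ¬ Near x

  far? : ∀ x → Dec (Far x)
  far? x = ¬? (x ≟ a) ×-dec ¬? (near? x)

  -- The ends of the second edge are far: a path p–m–r' would give an induced
  -- P₄ (q–p–m–r' or p–m–r'–s') or, if m sees q and s', a butterfly.
  far-end : ∀ {r' s'} → k p r' ≡ false → k q r' ≡ false → k p s' ≡ false → k q s' ≡ false →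
            k r' s' ≡ true → Far r'
  far-end {r'} {s'} pr' qr' ps' qs' r's' = off-a r's' , not-near
    where
    via : ∀ {m} → k p m ≡ true → k m r' ≡ true → ⊥
    via {m} pm mr' with k m q in mq | k m s' in ms'
    ... | false | _     = no-P4 (flip-edge pq) pm mr' (flip-edge mq) qr' pr'
    ... | true  | false = no-P4 pm mr' r's' pr' ps' ms'
    ... | true  | true  = no-butterfly (flip-edge pm) mq mr' ms' pq r's' pr' ps' qr' qs'
    not-near : ¬ Near r'
    not-near (inj₁ refl)                = clash (flip-edge pq) qr'
    not-near (inj₂ (inj₁ pr'-edge))      = clash pr'-edge pr'
    not-near (inj₂ (inj₂ (_ , pm , mr'))) = via pm mr'

  far-r : Far r
  far-r = far-end pr qr ps qs rs

  far-s : Far s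
  far-s = far-end ps qs pr qr (flip-edge rs)

  -- Far and near vertices see no alternating 4-cycle among themselves: beside
  -- it there would be the edge pq, resp. rs, with no edges to it.
  far-alt-free : ∀ {u x w y} → Far u → Far x → Far w → Far y → ¬ AltCycle k u x w y
  far-alt-free fu fx fw fy c = alt-beside-edge Far c fu fx fw fy pq (off-a pq)
    (λ (_ , ¬nt) → near-closed near-p ¬nt) (λ (_ , ¬nt) → near-closed near-q ¬nt)

  near-alt-free : ∀ {u x w y} → Near u → Near x → Near w → Near y → ¬ AltCycle k u x w y
  near-alt-free nu nx nw ny c = alt-beside-edge Near c nu nx nw ny rs (off-a rs)
    (λ nt → flip-edge (near-closed nt (proj₂ far-r)))
    (λ nt → flip-edge (near-closed nt (proj₂ far-s)))

  FarSet : VSet n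
  FarSet x = does (far? x)

  in-far : ∀ {x} → Far x → FarSet x ≡ true
  in-far {x} = dec-true (far? x)

  far-set-alt-free : AltFreeOn FarSet k
  far-set-alt-free Fu Fx Fw Fy =
    far-alt-free (true-witness (far? _) Fu) (true-witness (far? _) Fx)
                 (true-witness (far? _) Fw) (true-witness (far? _) Fy)

  open Vicinal k ks FarSet far-set-alt-free using (_≼_; _≼?_; ≼-total)

  Central : Fin n → Set
  Central x = Far x × ∃ λ w → Far w × w ≢ x × k x w ≡ true × w ≼ x

  central? : ∀ x → Dec (Central x)
  central? x = far? x ×-dec any? (λ w → far? w ×-dec ¬? (w ≟ x) ×-dec (k x w ≟ᵇ true) ×-dec (w ≼? x))

  C : VSet n
  C x = does (central? x)

  -- A central vertex c' is not below a far non-neighbour c: its witness w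
  -- would be a neighbour of c, and then c a neighbour of c'.
  not-below-non-neighbour : ∀ {c c'} → Far c → c ≢ c' → k c c' ≡ false → c' ≼ c → ¬ Central c'
  not-below-non-neighbour {c} {c'} fc c≢c' cc' c'≼c (_ , w , fw , w≢c' , c'w , w≼c') with w ≟ c
  ... | yes refl = clash c'w (flip-edge cc')
  ... | no w≢c   = clash (w≼c' (in-far fc) c≢c' (w≢c ∘ sym) (flip-edge (c'≼c (in-far fw) w≢c w≢c' c'w)))
                         (flip-edge cc')

  central-clique : ∀ {c c'} → Central c → Central c' → c ≢ c' → k c c' ≡ true
  central-clique {c} {c'} cc cc' c≢c' with k c c' in kcc' | ≼-total (in-far (proj₁ cc)) (in-far (proj₁ cc'))
  ... | true  | _        = refl
  ... | false | inj₁ c'≼c = ⊥-elim (not-below-non-neighbour (proj₁ cc) c≢c' kcc' c'≼c cc')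
  ... | false | inj₂ c≼c' =
    ⊥-elim (not-below-non-neighbour (proj₁ cc') (c≢c' ∘ sym) (flip-edge kcc') c≼c' cc)

  -- Adjacent far vertices are comparable, and the larger one is central.
  rest-independent : ∀ {i j} → Far i → Far j → ¬ Central i → ¬ Central j → i ≢ j → k i j ≡ false
  rest-independent {i} {j} fi fj ¬ci ¬cj i≢j with k i j in ij | ≼-total (in-far fi) (in-far fj)
  ... | false | _       = refl
  ... | true  | inj₁ j≼i = ⊥-elim (¬ci (fi , j , fj , i≢j ∘ sym , ij , j≼i))
  ... | true  | inj₂ i≼j = ⊥-elim (¬cj (fj , i , fi , i≢j , flip-edge ij , i≼j))

  far-apart : ∀ {i j} → Far i → ¬ Far j → k i j ≡ false
  far-apart {i} {j} fi ¬fj with j ≟ a | near? j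
  ... | yes refl | _      = flip-edge (isolated i)
  ... | no _     | yes nj = flip-edge (near-closed nj (proj₂ fi))
  ... | no j≢a   | no ¬nj = ⊥-elim (¬fj (j≢a , ¬nj))

  T : Adj n
  T = switchA k C

  T-symmetric : Symmetric T
  T-symmetric = switch-symmetric ks C

  T-loopless : Loopless T
  T-loopless = switch-loopless {k = k} kl C

  T-value : ∀ {i j b c d} → k i j ≡ b → C i ≡ c → C j ≡ d → T i j ≡ b xor (c xor d)
  T-value = switch-value {k = k} {S = C}

  C-in : ∀ {v} → Central v → C v ≡ true
  C-in {v} = dec-true (central? v)

  C-out : ∀ {v} → ¬ Central v → C v ≡ false
  C-out {v} = dec-false (central? v)

  T-central-central : ∀ {i j} → Central i → Central j → i ≢ j → T i j ≡ true
  T-central-central ci cj i≢j = T-value (central-clique ci cj i≢j) (C-in ci) (C-in cj)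

  T-central-outside : ∀ {i j} → Central i → ¬ Far j → T i j ≡ true
  T-central-outside ci ¬fj = T-value (far-apart (proj₁ ci) ¬fj) (C-in ci) (C-out (¬fj ∘ proj₁))

  T-central-rest : ∀ {i j} → Central i → ¬ Central j → T i j ≡ not (k i j)
  T-central-rest {i} ci ¬cj = trans (T-value refl (C-in ci) (C-out ¬cj)) (xor-comm (k i _) true)

  T-rest-rest : ∀ {i j} → Far i → Far j → ¬ Central i → ¬ Central j → i ≢ j → T i j ≡ false
  T-rest-rest fi fj ¬ci ¬cj i≢j = T-value (rest-independent fi fj ¬ci ¬cj i≢j) (C-out ¬ci) (C-out ¬cj)

  T-rest-outside : ∀ {i j} → Far i → ¬ Central i → ¬ Far j → T i j ≡ false
  T-rest-outside fi ¬ci ¬fj = T-value (far-apart fi ¬fj) (C-out ¬ci) (C-out (¬fj ∘ proj₁))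

  T-unswitched : ∀ {i j} → ¬ Central i → ¬ Central j → T i j ≡ k i j
  T-unswitched {i} {j} ¬ci ¬cj = trans (T-value refl (C-out ¬ci) (C-out ¬cj)) (xor-identityʳ (k i j))

  data Class (v : Fin n) : Set where
    central : Central v → Class v
    rest    : Far v → ¬ Central v → Class v
    outside : ¬ Far v → Class v

  classify : ∀ v → Class v
  classify v with central? v | far? v
  ... | yes cv | _      = central cv
  ... | no ¬cv | yes fv = rest fv ¬cv
  ... | no _   | no ¬fv = outside ¬fv

  -- A corner u of an alternating 4-cycle of T is not central: y, w, x are
  -- forced into the classes rest, central, rest, and then u y w x is an
  -- alternating 4-cycle of k among far vertices.
  central-corner : ∀ {u x w y} → AltCycle T u x w y → ¬ Central u
  central-corner {u} {x} {w} {y} (alt ux wy uy wx u≢y w≢x) cu with classify y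
  ... | central cy  = clash (T-central-central cu cy u≢y) uy
  ... | outside ¬fy = clash (T-central-outside cu ¬fy) uy
  ... | rest fy ¬cy with classify w
  ...   | rest fw ¬cw = clash wy (T-rest-rest fw fy ¬cw ¬cy (edge-distinct T-loopless wy))
  ...   | outside ¬fw = clash (trans (T-symmetric y w) wy) (T-rest-outside fy ¬cy ¬fw)
  ...   | central cw with classify x
  ...     | central cx  = clash (T-central-central cw cx w≢x) wx
  ...     | outside ¬fx = clash (T-central-outside cw ¬fx) wx
  ...     | rest fx ¬cx = far-alt-free (proj₁ cu) fy (proj₁ cw) fx
      (alt (not-flip (T-central-rest cu ¬cy) uy) (not-flip (T-central-rest cw ¬cx) wx)
           (not-flip (T-central-rest cu ¬cx) ux) (not-flip (T-central-rest cw ¬cy) wy)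
           (edge-distinct T-loopless ux) (edge-distinct T-loopless wy))

  far-corner : ∀ {u x} → T u x ≡ true → ¬ Central u → ¬ Central x → ¬ Far u
  far-corner {u} {x} ux ¬cu ¬cx fu with far? x
  ... | yes fx  = clash ux (T-rest-rest fu fx ¬cu ¬cx (edge-distinct T-loopless ux))
  ... | no ¬fx = clash ux (T-rest-outside fu ¬cu ¬fx)

  near-corner : ∀ {u x} → T u x ≡ true → ¬ Central u → ¬ Central x → Near u
  near-corner {u} {x} ux ¬cu ¬cx = decidable-stable (near? u) λ ¬nu →
    far-corner ux ¬cu ¬cx (u≢a , ¬nu)
    where
    u≢a : u ≢ a
    u≢a refl = clash (trans (sym (T-unswitched ¬cu ¬cx)) ux) (isolated x)

  -- All corners of an alternating 4-cycle of T are non-central, hence near;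
  -- there T agrees with k, contradicting near-alt-free.
  T-alt-free : AltFree T
  T-alt-free {u} {x} {w} {y} c@(alt ux wy uy wx u≢y w≢x) =
    near-alt-free (near-corner ux ¬cu ¬cx) (near-corner (flip ux) ¬cx ¬cu)
                  (near-corner wy ¬cw ¬cy) (near-corner (flip wy) ¬cy ¬cw)
      (alt (unswitch ¬cu ¬cx ux) (unswitch ¬cw ¬cy wy) (unswitch ¬cu ¬cy uy) (unswitch ¬cw ¬cx wx) u≢y w≢x)
    where
    ¬cu : ¬ Central u
    ¬cu = central-corner c
    ¬cw : ¬ Central w
    ¬cw = central-corner (alt-swap c)
    ¬cx : ¬ Central x
    ¬cx = central-corner (alt-reverse T-symmetric c)
    ¬cy : ¬ Central y
    ¬cy = central-corner (alt-swap (alt-reverse T-symmetric c))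
    flip : ∀ {i j} → T i j ≡ true → T j i ≡ true
    flip {i} {j} e = trans (T-symmetric j i) e
    unswitch : ∀ {i j b} → ¬ Central i → ¬ Central j → T i j ≡ b → k i j ≡ b
    unswitch ¬ci ¬cj e = trans (sym (T-unswitched ¬ci ¬cj)) e

  alt-free-switching : ∃ λ S → AltFree (switchA k S)
  alt-free-switching = C , T-alt-free

complement : ∀ {n} → Adj n → Adj n
complement k i j = if does (i ≟ j) then false else not (k i j)

complement-off-diagonal : ∀ {n} (k : Adj n) {i j} → i ≢ j → complement k i j ≡ not (k i j)
complement-off-diagonal k {i} {j} i≢j with i ≟ j
... | yes i≡j = ⊥-elim (i≢j i≡j)
... | no _    = refl

complement-loopless : ∀ {n} (k : Adj n) → Loopless (complement k)
complement-loopless k i with i ≟ i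
... | yes _  = refl
... | no i≢i = ⊥-elim (i≢i refl)

complement-symmetric : ∀ {n} {k : Adj n} → Symmetric k → Symmetric (complement k)
complement-symmetric ks i j with i ≟ j | j ≟ i
... | yes _    | yes _    = refl
... | yes refl | no j≢i   = ⊥-elim (j≢i refl)
... | no i≢j   | yes refl = ⊥-elim (i≢j refl)
... | no _     | no _     = cong not (ks i j)

complement-involutive : ∀ {n} {k : Adj n} → Loopless k → complement (complement k) ≗₂ k
complement-involutive {k = k} kl i j with i ≟ j
... | yes refl = sym (kl i)
... | no _     = not-involutive (k i j)

switch-complement : ∀ {n} (k : Adj n) R {i j} → i ≢ j → switchA (complement k) R i j ≡ not (switchA k R i j)
switch-complement k R {i} {j} i≢j =
  trans (cong (_xor (R i xor R j)) (complement-off-diagonal k i≢j)) (sym (not-distribˡ-xor (k i j) _))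

copy-complement : ∀ {n m} {k : Adj n} {x : Adj m} → Copy k x → Copy (complement k) (complement x)
copy-complement {k = k} {x} (f , inj , S , eq) = f , inj , S , entry
  where
  entry : ∀ i j → switchA (restrict (complement k) f) S i j ≡ complement x i j
  entry i j with i ≟ j
  ... | yes refl = switch-loopless {k = restrict (complement k) f} (complement-loopless k ∘ f) S i
  ... | no i≢j   = begin
    complement k (f i) (f j) xor (S i xor S j)
      ≡⟨ cong (_xor (S i xor S j)) (complement-off-diagonal k (i≢j ∘ inj)) ⟩
    not (k (f i) (f j)) xor (S i xor S j)      ≡⟨ sym (not-distribˡ-xor (k (f i) (f j)) _) ⟩
    not (switchA (restrict k f) S i j)         ≡⟨ cong not (eq i j) ⟩
    not (x i j)                                ∎
    where open ≡-Reasoning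

-- The forbidden family is closed under complementation, up to switching:
-- the complements of 3K₂ and C₄ + 2K₁ are each other's switchings at {4, 5}
-- (after exchanging vertices 1 and 2), and C₅ is self-complementary.
swap₁₂ : Fin 6 → Fin 6
swap₁₂ = lookup (# 0 ∷ # 2 ∷ # 1 ∷ # 3 ∷ # 4 ∷ # 5 ∷ [])

last-two : VSet 6
last-two = lookup (false ∷ false ∷ false ∷ false ∷ true ∷ true ∷ [])

complement-3K2 : Copy (complement adj3K2) adjC4K1K1
complement-3K2 = copy-by-evaluation (complement adj3K2) adjC4K1K1 swap₁₂ swap₁₂ last-two

complement-C4+2K1 : Copy (complement adjC4K1K1) adj3K2
complement-C4+2K1 = copy-by-evaluation (complement adjC4K1K1) adj3K2 swap₁₂ swap₁₂ last-two

complement-C5 : Copy (complement adjC5) adjC5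
complement-C5 = copy-by-evaluation (complement adjC5) adjC5
  (lookup (# 0 ∷ # 2 ∷ # 4 ∷ # 1 ∷ # 3 ∷ []))
  (lookup (# 0 ∷ # 3 ∷ # 1 ∷ # 4 ∷ # 2 ∷ []))
  (λ _ → false)

-- A copy in the complement is a copy of the complement, hence of a forbidden graph.
copy-free-complement : ∀ {n} {k : Adj n} → Loopless k → CopyFree k → CopyFree (complement k)
copy-free-complement {k = k} kl free = record
  { no-3K2    = λ c → no-C4+2K1 (copy-compose {k = k} {complement adj3K2} (back c) complement-3K2)
  ; no-C5     = λ c → no-C5 (copy-compose {k = k} {complement adjC5} (back c) complement-C5)
  ; no-C4+2K1 = λ c → no-3K2 (copy-compose {k = k} {complement adjC4K1K1} (back c) complement-C4+2K1)
  }
  where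
  open CopyFree free
  back : ∀ {m} {x : Adj m} → Copy (complement k) x → Copy k (complement x)
  back {x = x} c = copy-source {k = complement (complement k)} (complement-involutive kl)
                                (copy-complement {k = complement k} {x} c)

-- The complement on V - a, with a kept isolated, is the complement switched
-- at {a}.  It inherits all hypotheses, and turns a C₄ into a 2K₂.
module ComplementAway {n} (k : Adj n) (ks : Symmetric k) (kl : Loopless k)
  (a : Fin n) (isolated : ∀ x → k a x ≡ false) (free : CopyFree k) where

  open Configurations k ks kl a isolated free using (flip-edge; off-a)

  δ : VSet n
  δ i = does (i ≟ a)

  δ-a : δ a ≡ true
  δ-a = dec-true (a ≟ a) refl

  δ-out : ∀ {i} → i ≢ a → δ i ≡ false
  δ-out {i} = dec-false (i ≟ a)

  kc : Adj n
  kc = switchA (complement k) δ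

  kc-symmetric : Symmetric kc
  kc-symmetric = switch-symmetric (complement-symmetric ks) δ

  kc-loopless : Loopless kc
  kc-loopless = switch-loopless {k = complement k} (complement-loopless k) δ

  kc-isolated : ∀ x → kc a x ≡ false
  kc-isolated x = by-cases (x ≟ a)
    where
    by-cases : Dec (x ≡ a) → kc a x ≡ false
    by-cases (yes refl) = kc-loopless a
    by-cases (no x≢a)   = switch-value {k = complement k} {S = δ}
      (trans (complement-off-diagonal k (x≢a ∘ sym)) (cong not (isolated x))) δ-a (δ-out x≢a)

  kc-value : ∀ {i j b} → i ≢ a → j ≢ a → i ≢ j → k i j ≡ b → kc i j ≡ not b
  kc-value {i} {j} i≢a j≢a i≢j e =
    trans (switch-value {k = complement k} {S = δ} (complement-off-diagonal k i≢j) (δ-out i≢a) (δ-out j≢a))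
          (trans (xor-identityʳ (not (k i j))) (cong not e))

  kc-copy-free : CopyFree kc
  kc-copy-free = copy-free-switch (copy-free-complement kl free) δ

  -- Switching kc by S and k by δ ⊕ S gives complementary graphs, and the
  -- complement of an alternating 4-cycle is one.
  alt-free-back : ∀ S → AltFree (switchA kc S) → AltFree (switchA k (δ ⊕ S))
  alt-free-back S alt-free c =
    alt-free (alt-complement {k = switchA kc S} (switch-loopless {k = k} kl (δ ⊕ S)) opposite c)
    where
    opposite : ∀ {i j} → i ≢ j → switchA k (δ ⊕ S) i j ≡ not (switchA kc S i j)
    opposite {i} {j} i≢j = not-flip (trans (switch-twice (complement k) δ S i j)
                                           (switch-complement k (δ ⊕ S) i≢j)) refl

  -- A C₄ u–x–y–w of k is the 2K₂ uy, xw of kc.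
  from-C4 : ∀ {u x w y} → AltCycle k u x w y → k u w ≡ true → k x y ≡ true →
            ∃ λ S → AltFree (switchA k S)
  from-C4 {u} {x} {w} {y} (alt ux wy uy wx u≢y w≢x) uw xy =
    δ ⊕ proj₁ cleared , alt-free-back (proj₁ cleared) (proj₂ cleared)
    where
    u≢a : u ≢ a
    u≢a = off-a ux
    x≢a : x ≢ a
    x≢a = off-a (flip-edge ux)
    w≢a : w ≢ a
    w≢a = off-a wy
    y≢a : y ≢ a
    y≢a = off-a (flip-edge wy)
    cleared : ∃ λ S → AltFree (switchA kc S)
    cleared = TwoK2.alt-free-switching kc kc-symmetric kc-loopless a kc-isolated kc-copy-free
                {u} {y} {x} {w}
      (kc-value u≢a y≢a u≢y uy)
      (kc-value x≢a w≢a (w≢x ∘ sym) (flip-edge wx))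
      (kc-value u≢a x≢a (edge-distinct kl ux) ux)
      (kc-value u≢a w≢a (edge-distinct kl uw) uw)
      (kc-value y≢a x≢a (edge-distinct kl xy ∘ sym) (flip-edge xy))
      (kc-value y≢a w≢a (edge-distinct kl wy ∘ sym) (flip-edge wy))

-- An alternating 4-cycle, if any,
-- is a 2K₂ (handled by TwoK2) or a C₄ (a 2K₂ of the complement on V - a).
alt-free-switching : ∀ {n} (k : Adj n) → Symmetric k → Loopless k →
                     (a : Fin n) → (∀ x → k a x ≡ false) → CopyFree k → ∃ λ S → AltFree (switchA k S)
alt-free-switching k ks kl a isolated free with hasAltCycle? k
... | no none = (λ _ → false) , λ c → none (_ , _ , _ , _ , alt-cong (switch-empty k) c)
... | yes (u , x , w , y , c@(alt ux wy uy wx _ _))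
  with k u w in uw | k x y in xy | Configurations.alt-diagonals k ks kl a isolated free c
...   | false | false | _ = TwoK2.alt-free-switching k ks kl a isolated free ux wy uw uy (trans (ks x w) wx) xy
...   | true  | true  | _ = ComplementAway.from-C4 k ks kl a isolated free c uw xy

isolating-switch : ∀ {n} (G : Graph n) (a : Fin n) → ∀ x → switchAdj G (adj G a) a x ≡ false
isolating-switch G a x = trans (cong (λ b → adj G a x xor (b xor adj G a x)) (irrefl G a)) (xor-same (adj G a x))

copy-free→switching-threshold : ∀ {n} (G : Graph n) → CopyFree (adj G) → SwitchingThreshold G
copy-free→switching-threshold {zero} G _ = (λ ()) , λ { _ (() , _) }
copy-free→switching-threshold {suc n} G free
  with alt-free-switching (switchAdj G (adj G zero)) (Graph.sym (switch G (adj G zero)))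
         (irrefl (switch G (adj G zero))) zero (isolating-switch G zero) (copy-free-switch free (adj G zero))
... | S , alt-free =
  adj G zero ⊕ S ,
  threshold-cong (switch-twice (adj G) (adj G zero) S)
    (alt-free→threshold (switch-symmetric (Graph.sym (switch G (adj G zero))) S) alt-free)

theorem7 : ∀ {n} (G : Graph n) →
    SwitchingThreshold G ⇔
      (¬ HasInducedSwitchingCopy G 3K2 × ¬ HasInducedSwitchingCopy G C5
        × ¬ HasInducedSwitchingCopy G C4+2K1)
theorem7 G = mk⇔
  (λ st → switching-threshold→no-copy G 3K2 (every-switching-alt 3K2) st
        , switching-threshold→no-copy G C5 (every-switching-alt C5) st
        , switching-threshold→no-copy G C4+2K1 (every-switching-alt C4+2K1) st)
  (λ (no-3K2 , no-C5 , no-C4+2K1) →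
     copy-free→switching-threshold G (record { no-3K2 = no-3K2 ; no-C5 = no-C5 ; no-C4+2K1 = no-C4+2K1 }))
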